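{- Let $E=(e_X,e_Y,R)$ be an extension polarity extending the poset $P$ (so $e_X:P\to X$, $e_Y:P\to Y$). The following are equivalent: (1) $E$ is 1-coherent; (2) $\preceq_1$ is a 1-preorder for $E$; (3) there exists a 1-preorder for $E$. Moreover, the set of 1-preorders for $E$ is closed under non-empty intersections and, if it is non-empty, has $\preceq_1$ as its smallest member.
   Context: An extension polarity is a triple $(e_X,e_Y,R)$ where $P$ is a poset, $X,Y$ are disjoint posets, $e_X:P\to X$ and $e_Y:P\to Y$ are order embeddings, and $R\subseteq X\times Y$. Coherence conditions: (C1) for all $x_1,x_2\in X$, $y\in Y$: if $x_1\le_X x_2$ and $x_2\mathrel{R}y$ then $x_1\mathrel{R}y$. (C2) for all $y_1,y_2\in Y$, $x\in X$: if $y_1\le_Y y_2$ and $x\mathrel{R}y_1$ then $x\mathrel{R}y_2$. (C3) for all $p\in P$: $e_X(p)\mathrel{R}e_Y(p)$. (C4) for all $p\in P$, $x\in X$, $y\in Y$: if $x\mathrel{R}e_Y(p)$ and $e_X(p)\mathrel{R}y$ then $x\mathrel{R}y$. $E$ is 1-coherent if it satisfies (C1)–(C4). For a preorder $\preceq$ on $X\cup Y$, let $X\uplus_\preceq Y$ be the poset obtained by identifying $z_1,z_2$ whenever $z_1\preceq z_2\preceq z_1$, and let $\iota_X:X\to X\uplus_\preceq Y$, $\iota_Y:Y\to X\uplus_\preceq Y$ be the inclusions followed by the quotient map. A 0-preorder for $E$ is a preorder $\preceq$ on $X\cup Y$ with: $x\preceq y\iff x\mathrel{R}y$ for $x\in X,y\in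 Y$; $x_1\le_X x_2\Rightarrow x_1\preceq x_2$; $y_1\le_Y y_2\Rightarrow y_1\preceq y_2$. A 1-preorder for $E$ is a 0-preorder with $\iota_X\circ e_X=\iota_Y\circ e_Y$. The relation $\preceq_1\subseteq (X\cup Y)^2$ is the union of $R$ with $Z_X=\{(x_1,x_2)\in X^2:\exists p\in P\,(x_1\mathrel{R}e_Y(p)\text{ and }e_X(p)\le_X x_2)\}\cup{\le_X}$, $Z_Y=\{(y_1,y_2)\in Y^2:\exists p\in P\,(y_1\le_Y e_Y(p)\text{ and }e_X(p)\mathrel{R}y_2)\}\cup{\le_Y}$, $Z_{YX}=\{(y,x)\in Y\times X:\exists p,q\in P\,(y\le_Y e_Y(p),\ e_X(p)\mathrel{R}e_Y(q),\ e_X(q)\le_X x)\}$. -}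

module Defs where

open import Level using (0ℓ)
open import Relation.Binary.Bundles using (Poset)
open import Relation.Binary.Core using (Rel; REL)
open import Data.Sum using (_⊎_; inj₁; inj₂)
open import Data.Product using (_×_; ∃; ∃₂)
open import Function.Bundles using (_⇔_)

IsOrderEmbedding : (P Q : Poset 0ℓ 0ℓ 0ℓ) → (Poset.Carrier P → Poset.Carrier Q) → Set
IsOrderEmbedding P Q e =
  ∀ p q → (Poset._≤_ P p q ⇔ Poset._≤_ Q (e p) (e q))

-- Extension polarity extending P.  X and Y are kept disjoint by
-- forming their union as the disjoint sum X ⊎ Y.
record ExtensionPolarity (P : Poset 0ℓ 0ℓ 0ℓ) : Set₁ where
  field
    X Y   : Poset 0ℓ 0ℓ 0ℓ
    eX    : Poset.Carrier P → Poset.Carrier X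
    eY    : Poset.Carrier P → Poset.Carrier Y
    eX-emb : IsOrderEmbedding P X eX
    eY-emb : IsOrderEmbedding P Y eY
    R     : REL (Poset.Carrier X) (Poset.Carrier Y) 0ℓ

module _ {P : Poset 0ℓ 0ℓ 0ℓ} (E : ExtensionPolarity P) where
  open ExtensionPolarity E
  open Poset P using () renaming (Carrier to |P|)
  open Poset X using () renaming (Carrier to |X|; _≤_ to _≤X_)
  open Poset Y using () renaming (Carrier to |Y|; _≤_ to _≤Y_)

  XY : Set
  XY = |X| ⊎ |Y|

  record OneCoherent : Set where
    field
      C1 : ∀ x₁ x₂ y → x₁ ≤X x₂ → R x₂ y → R x₁ y
      C2 : ∀ y₁ y₂ x → y₁ ≤Y y₂ → R x y₁ → R x y₂
      C3 : ∀ p → R (eX p) (eY p)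
      C4 : ∀ p x y → R x (eY p) → R (eX p) y → R x y

  record IsPreorderOn (_≼_ : Rel XY 0ℓ) : Set where
    field
      refl  : ∀ z → z ≼ z
      trans : ∀ z₁ z₂ z₃ → z₁ ≼ z₂ → z₂ ≼ z₃ → z₁ ≼ z₃

  record IsZeroPreorder (_≼_ : Rel XY 0ℓ) : Set where
    field
      preorder : IsPreorderOn _≼_
      XY-R     : ∀ x y → (inj₁ x ≼ inj₂ y ⇔ R x y)
      mono-X   : ∀ x₁ x₂ → x₁ ≤X x₂ → inj₁ x₁ ≼ inj₁ x₂
      mono-Y   : ∀ y₁ y₂ → y₁ ≤Y y₂ → inj₂ y₁ ≼ inj₂ y₂

  -- ι_X ∘ e_X = ι_Y ∘ e_Y in the quotient X ⊎_≼ Y means exactly that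
  -- e_X p and e_Y p are ≼-equivalent, for every p.
  record IsOnePreorder (_≼_ : Rel XY 0ℓ) : Set where
    field
      zero-preorder : IsZeroPreorder _≼_
      glue-XY : ∀ p → inj₁ (eX p) ≼ inj₂ (eY p)
      glue-YX : ∀ p → inj₂ (eY p) ≼ inj₁ (eX p)

  -- The relation ≼₁ = R ∪ Z_X ∪ Z_Y ∪ Z_YX, split by components.
  _≼₁_ : Rel XY 0ℓ
  inj₁ x  ≼₁ inj₂ y  = R x y
  inj₁ x₁ ≼₁ inj₁ x₂ = (∃ λ (p : |P|) → R x₁ (eY p) × eX p ≤X x₂) ⊎ x₁ ≤X x₂
  inj₂ y₁ ≼₁ inj₂ y₂ = (∃ λ (p : |P|) → y₁ ≤Y eY p × R (eX p) y₂) ⊎ y₁ ≤Y y₂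
  inj₂ y  ≼₁ inj₁ x  = ∃₂ λ (p q : |P|) → y ≤Y eY p × R (eX p) (eY q) × eX q ≤X x

{-# OPTIONS --safe #-}
module Submission where

open import Defs
open import Level using (0ℓ)
open import Relation.Binary.Bundles using (Poset)
open import Relation.Binary.Core using (Rel; _⇒_)
open import Relation.Binary.Structures using (IsPreorder)
open import Relation.Binary.PropositionalEquality using (_≡_; isEquivalence; refl)
open import Data.Product using (_×_; ∃; _,_)
open import Data.Sum using (inj₁; inj₂)
open import Function.Bundles using (_⇔_; mk⇔; Equivalence)

-- Every 1-preorder contains ≤_X, ≤_Y, R and the glueing e_Y p ≼ e_X p, hence
-- each composite of these listed in Z_X, Z_Y and Z_YX; and it satisfies
-- (C1)–(C4) by transitivity through e_Y p ~ e_X p. Conversely (C1)–(C4) are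
-- exactly what makes the collection ≼₁ of those composites closed under
-- composition, so it is then itself a 1-preorder, necessarily the least one.

module _ {P : Poset 0ℓ 0ℓ 0ℓ} (E : ExtensionPolarity P) where
  open ExtensionPolarity E
  open Poset X using () renaming (_≤_ to _≤X_; refl to ≤X-refl; trans to ≤X-trans)
  open Poset Y using () renaming (_≤_ to _≤Y_; refl to ≤Y-refl; trans to ≤Y-trans)

  module OnePreorderProperties {_≼_ : Rel (XY E) 0ℓ} (op : IsOnePreorder E _≼_) where
    open IsOnePreorder op
    open IsZeroPreorder zero-preorder
    open IsPreorderOn preorder using (trans)

    ≼-isPreorder : IsPreorder _≡_ _≼_
    ≼-isPreorder = record
      { isEquivalence = isEquivalence
      ; reflexive     = λ { {z} refl → IsPreorderOn.refl preorder z }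
      ; trans         = trans _ _ _
      }

    open import Relation.Binary.Reasoning.Base.Double ≼-isPreorder public

    R⇒≼ : ∀ {x y} → R x y → inj₁ x ≼ inj₂ y
    R⇒≼ {x} {y} = Equivalence.from (XY-R x y)

    ≼⇒R : ∀ {x y} → inj₁ x ≼ inj₂ y → R x y
    ≼⇒R {x} {y} = Equivalence.to (XY-R x y)

    ≤X⇒≼ : ∀ {x₁ x₂} → x₁ ≤X x₂ → inj₁ x₁ ≼ inj₁ x₂
    ≤X⇒≼ = mono-X _ _

    ≤Y⇒≼ : ∀ {y₁ y₂} → y₁ ≤Y y₂ → inj₂ y₁ ≼ inj₂ y₂
    ≤Y⇒≼ = mono-Y _ _

  module _ {_≼_ : Rel (XY E) 0ℓ} (op : IsOnePreorder E _≼_) where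
    open IsOnePreorder op using (glue-XY; glue-YX)
    open OnePreorderProperties op

    isOnePreorder⇒oneCoherent : OneCoherent E
    isOnePreorder⇒oneCoherent = record
      { C1 = λ x₁ x₂ y x₁≤x₂ x₂Ry → ≼⇒R (begin
          inj₁ x₁ ≲⟨ ≤X⇒≼ x₁≤x₂ ⟩
          inj₁ x₂ ≲⟨ R⇒≼ x₂Ry ⟩
          inj₂ y  ∎)
      ; C2 = λ y₁ y₂ x y₁≤y₂ xRy₁ → ≼⇒R (begin
          inj₁ x  ≲⟨ R⇒≼ xRy₁ ⟩
          inj₂ y₁ ≲⟨ ≤Y⇒≼ y₁≤y₂ ⟩
          inj₂ y₂ ∎)
      ; C3 = λ p → ≼⇒R (glue-XY p)
      ; C4 = λ p x y xReYp eXpRy → ≼⇒R (begin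
          inj₁ x      ≲⟨ R⇒≼ xReYp ⟩
          inj₂ (eY p) ≲⟨ glue-YX p ⟩
          inj₁ (eX p) ≲⟨ R⇒≼ eXpRy ⟩
          inj₂ y      ∎)
      }

    ≼₁⊆onePreorder : _≼₁_ E ⇒ _≼_
    ≼₁⊆onePreorder {inj₁ x} {inj₂ y} xRy = R⇒≼ xRy
    ≼₁⊆onePreorder {inj₁ x₁} {inj₁ x₂} (inj₂ x₁≤x₂) = ≤X⇒≼ x₁≤x₂
    ≼₁⊆onePreorder {inj₂ y₁} {inj₂ y₂} (inj₂ y₁≤y₂) = ≤Y⇒≼ y₁≤y₂
    ≼₁⊆onePreorder {inj₁ x₁} {inj₁ x₂} (inj₁ (p , x₁ReYp , eXp≤x₂)) = begin
      inj₁ x₁     ≲⟨ R⇒≼ x₁ReYp ⟩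
      inj₂ (eY p) ≲⟨ glue-YX p ⟩
      inj₁ (eX p) ≲⟨ ≤X⇒≼ eXp≤x₂ ⟩
      inj₁ x₂     ∎
    ≼₁⊆onePreorder {inj₂ y₁} {inj₂ y₂} (inj₁ (p , y₁≤eYp , eXpRy₂)) = begin
      inj₂ y₁     ≲⟨ ≤Y⇒≼ y₁≤eYp ⟩
      inj₂ (eY p) ≲⟨ glue-YX p ⟩
      inj₁ (eX p) ≲⟨ R⇒≼ eXpRy₂ ⟩
      inj₂ y₂     ∎
    ≼₁⊆onePreorder {inj₂ y} {inj₁ x} (p , q , y≤eYp , eXpReYq , eXq≤x) = begin
      inj₂ y      ≲⟨ ≤Y⇒≼ y≤eYp ⟩
      inj₂ (eY p) ≲⟨ glue-YX p ⟩
      inj₁ (eX p) ≲⟨ R⇒≼ eXpReYq ⟩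
      inj₂ (eY q) ≲⟨ glue-YX q ⟩
      inj₁ (eX q) ≲⟨ ≤X⇒≼ eXq≤x ⟩
      inj₁ x      ∎

  -- Transitivity of ≼₁ reduces to closing it under precomposition with the
  -- generators ≤_X, ≤_Y, R and the two glueing steps through e_Y p ~ e_X p.
  module _ (coh : OneCoherent E) where
    open OneCoherent coh

    ≤X-≼₁-trans : ∀ {x₁ x₂} c → x₁ ≤X x₂ → _≼₁_ E (inj₁ x₂) c → _≼₁_ E (inj₁ x₁) c
    ≤X-≼₁-trans (inj₁ x₃) x₁≤x₂ (inj₁ (q , x₂ReYq , eXq≤x₃)) = inj₁ (q , C1 _ _ _ x₁≤x₂ x₂ReYq , eXq≤x₃)
    ≤X-≼₁-trans (inj₁ x₃) x₁≤x₂ (inj₂ x₂≤x₃) = inj₂ (≤X-trans x₁≤x₂ x₂≤x₃)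
    ≤X-≼₁-trans (inj₂ y)  x₁≤x₂ x₂Ry = C1 _ _ _ x₁≤x₂ x₂Ry

    ≤Y-≼₁-trans : ∀ {y₁ y₂} c → y₁ ≤Y y₂ → _≼₁_ E (inj₂ y₂) c → _≼₁_ E (inj₂ y₁) c
    ≤Y-≼₁-trans (inj₁ x)  y₁≤y₂ (p , q , y₂≤eYp , r , l) = p , q , ≤Y-trans y₁≤y₂ y₂≤eYp , r , l
    ≤Y-≼₁-trans (inj₂ y₃) y₁≤y₂ (inj₁ (p , y₂≤eYp , r)) = inj₁ (p , ≤Y-trans y₁≤y₂ y₂≤eYp , r)
    ≤Y-≼₁-trans (inj₂ y₃) y₁≤y₂ (inj₂ y₂≤y₃) = inj₂ (≤Y-trans y₁≤y₂ y₂≤y₃)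

    R-≼₁-trans : ∀ {x y} c → R x y → _≼₁_ E (inj₂ y) c → _≼₁_ E (inj₁ x) c
    R-≼₁-trans (inj₁ x′) xRy (p , q , y≤eYp , eXpReYq , eXq≤x′) =
      inj₁ (q , C4 p _ _ (C2 _ _ _ y≤eYp xRy) eXpReYq , eXq≤x′)
    R-≼₁-trans (inj₂ y′) xRy (inj₁ (p , y≤eYp , eXpRy′)) = C4 p _ _ (C2 _ _ _ y≤eYp xRy) eXpRy′
    R-≼₁-trans (inj₂ y′) xRy (inj₂ y≤y′) = C2 _ _ _ y≤y′ xRy

    R-glue-≼₁-trans : ∀ {x p} c → R x (eY p) → _≼₁_ E (inj₁ (eX p)) c → _≼₁_ E (inj₁ x) c
    R-glue-≼₁-trans {p = p} (inj₁ x′) xReYp (inj₁ (q , eXpReYq , eXq≤x′)) =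
      inj₁ (q , C4 p _ _ xReYp eXpReYq , eXq≤x′)
    R-glue-≼₁-trans {p = p} (inj₁ x′) xReYp (inj₂ eXp≤x′) = inj₁ (p , xReYp , eXp≤x′)
    R-glue-≼₁-trans {p = p} (inj₂ y)  xReYp eXpRy = C4 p _ _ xReYp eXpRy

    ≤Y-glue-≼₁-trans : ∀ {y p} c → y ≤Y eY p → _≼₁_ E (inj₁ (eX p)) c → _≼₁_ E (inj₂ y) c
    ≤Y-glue-≼₁-trans {p = p} (inj₁ x) y≤eYp (inj₁ (q , eXpReYq , eXq≤x)) = p , q , y≤eYp , eXpReYq , eXq≤x
    ≤Y-glue-≼₁-trans {p = p} (inj₁ x) y≤eYp (inj₂ eXp≤x) = p , p , y≤eYp , C3 p , eXp≤x
    ≤Y-glue-≼₁-trans {p = p} (inj₂ y′) y≤eYp eXpRy′ = inj₁ (p , y≤eYp , eXpRy′)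

    ≼₁-trans : ∀ a b c → _≼₁_ E a b → _≼₁_ E b c → _≼₁_ E a c
    ≼₁-trans (inj₁ x₁) (inj₁ x₂) c (inj₁ (p , x₁ReYp , eXp≤x₂)) x₂≼c =
      R-glue-≼₁-trans c x₁ReYp (≤X-≼₁-trans c eXp≤x₂ x₂≼c)
    ≼₁-trans (inj₁ x₁) (inj₁ x₂) c (inj₂ x₁≤x₂) x₂≼c = ≤X-≼₁-trans c x₁≤x₂ x₂≼c
    ≼₁-trans (inj₁ x) (inj₂ y) c xRy y≼c = R-≼₁-trans c xRy y≼c
    ≼₁-trans (inj₂ y) (inj₁ x) c (p , q , y≤eYp , eXpReYq , eXq≤x) x≼c =
      ≤Y-glue-≼₁-trans c y≤eYp (R-glue-≼₁-trans c eXpReYq (≤X-≼₁-trans c eXq≤x x≼c))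
    ≼₁-trans (inj₂ y₁) (inj₂ y₂) c (inj₁ (p , y₁≤eYp , eXpRy₂)) y₂≼c =
      ≤Y-glue-≼₁-trans c y₁≤eYp (R-≼₁-trans c eXpRy₂ y₂≼c)
    ≼₁-trans (inj₂ y₁) (inj₂ y₂) c (inj₂ y₁≤y₂) y₂≼c = ≤Y-≼₁-trans c y₁≤y₂ y₂≼c

    ≼₁-refl : ∀ a → _≼₁_ E a a
    ≼₁-refl (inj₁ x) = inj₂ ≤X-refl
    ≼₁-refl (inj₂ y) = inj₂ ≤Y-refl

    oneCoherent⇒isOnePreorder-≼₁ : IsOnePreorder E (_≼₁_ E)
    oneCoherent⇒isOnePreorder-≼₁ = record
      { zero-preorder = record
        { preorder = record { refl = ≼₁-refl ; trans = ≼₁-trans }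
        ; XY-R     = λ x y → mk⇔ (λ r → r) (λ r → r)
        ; mono-X   = λ _ _ → inj₂
        ; mono-Y   = λ _ _ → inj₂
        }
      ; glue-XY = C3
      ; glue-YX = λ p → p , p , ≤Y-refl , C3 p , ≤X-refl
      }

  ⋂ : {I : Set} → (I → Rel (XY E) 0ℓ) → Rel (XY E) 0ℓ
  ⋂ F a b = ∀ i → F i a b

  ⋂-isPreorderOn : ∀ {I} {F : I → Rel (XY E) 0ℓ} →
                   (∀ i → IsPreorderOn E (F i)) → IsPreorderOn E (⋂ F)
  ⋂-isPreorderOn pre = record
    { refl  = λ z i → IsPreorderOn.refl (pre i) z
    ; trans = λ a b c a≼b b≼c i → IsPreorderOn.trans (pre i) a b c (a≼b i) (b≼c i)
    }

  -- The index i₀ is needed only for the R-direction of XY-R: an empty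
  -- intersection relates every x to every y.
  ⋂-isZeroPreorder : ∀ {I} {F : I → Rel (XY E) 0ℓ} → I →
                     (∀ i → IsZeroPreorder E (F i)) → IsZeroPreorder E (⋂ F)
  ⋂-isZeroPreorder i₀ zp = record
    { preorder = ⋂-isPreorderOn (λ i → IsZeroPreorder.preorder (zp i))
    ; XY-R     = λ x y → mk⇔ (λ xRy → Equivalence.to (IsZeroPreorder.XY-R (zp i₀) x y) (xRy i₀))
                             (λ xRy i → Equivalence.from (IsZeroPreorder.XY-R (zp i) x y) xRy)
    ; mono-X   = λ x₁ x₂ x₁≤x₂ i → IsZeroPreorder.mono-X (zp i) x₁ x₂ x₁≤x₂
    ; mono-Y   = λ y₁ y₂ y₁≤y₂ i → IsZeroPreorder.mono-Y (zp i) y₁ y₂ y₁≤y₂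
    }

  ⋂-isOnePreorder : ∀ {I} {F : I → Rel (XY E) 0ℓ} → I →
                    (∀ i → IsOnePreorder E (F i)) → IsOnePreorder E (⋂ F)
  ⋂-isOnePreorder i₀ op = record
    { zero-preorder = ⋂-isZeroPreorder i₀ (λ i → IsOnePreorder.zero-preorder (op i))
    ; glue-XY       = λ p i → IsOnePreorder.glue-XY (op i) p
    ; glue-YX       = λ p i → IsOnePreorder.glue-YX (op i) p
    }

theorem3p11 : {P : Poset 0ℓ 0ℓ 0ℓ} (E : ExtensionPolarity P) →
      (OneCoherent E ⇔ IsOnePreorder E (_≼₁_ E))
    × (IsOnePreorder E (_≼₁_ E) ⇔ (∃ λ (≼ : Rel (XY E) 0ℓ) → IsOnePreorder E ≼))
    × (∀ (I : Set) (F : I → Rel (XY E) 0ℓ) → I → (∀ i → IsOnePreorder E (F i))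
        → IsOnePreorder E (λ a b → ∀ i → F i a b))
    × ((∃ λ (≼ : Rel (XY E) 0ℓ) → IsOnePreorder E ≼)
        → IsOnePreorder E (_≼₁_ E)
          × (∀ (≼ : Rel (XY E) 0ℓ) → IsOnePreorder E ≼ → ∀ a b → _≼₁_ E a b → ≼ a b))
theorem3p11 E =
    mk⇔ (oneCoherent⇒isOnePreorder-≼₁ E) (isOnePreorder⇒oneCoherent E)
  , mk⇔ (λ op → _ , op) (λ { (_ , op) → ≼₁-isOnePreorder op })
  , (λ I F → ⋂-isOnePreorder E)
  , (λ { (_ , op) → ≼₁-isOnePreorder op , λ _ op′ _ _ → ≼₁⊆onePreorder E op′ })
  where
    ≼₁-isOnePreorder : ∀ {≼} → IsOnePreorder E ≼ → IsOnePreorder E (_≼₁_ E)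
    ≼₁-isOnePreorder op = oneCoherent⇒isOnePreorder-≼₁ E (isOnePreorder⇒oneCoherent E op)
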